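{- Let $p$ be a prime and let $A=(a_{ij})$ be an $n \times n$ subring matrix with columns $v_1,\dots,v_n$ and diagonal $(p^{e_1},p^{e_2},\ldots, p^{e_{n-1}},1)$, where $e_1,\dots,e_{n-1}\ge 0$. Let $I = \{i_1,i_2,\ldots, i_k\}$ with $1 \le i_1<i_2<\cdots < i_k \le n-1$ be the set of indices $j\in\{1,\dots,n-1\}$ with $e_j \neq 0$. \begin{enumerate} \item For any $j_1, j_2$ with $1\le j_1 \le j_2 \le k$, we have $v_{i_{j_1}} \circ v_{i_{j_2}} \in \operatorname{Span}_{\mathbb Z}(v_{i_1},v_{i_2},\ldots, v_{i_k})$. \item Take the $n \times k$ matrix with columns $v_{i_1},\ldots, v_{i_k}$, delete its $j$-th row for every $j \notin I$ to get a $k\times k$ matrix, then append a bottom row of zeros and a final column all of whose entries are $1$. The resulting $(k+1) \times (k+1)$ matrix is an irreducible subring matrix. \item For any $j_1, j_2$ with $1\le j_1 \le j_2 \le k$, we have $p \mid a_{i_{j_1} i_{j_2}}$. \item If $i \in I$, then every entry of the column $v_i$ is divisible by $p$. \end{enumerate}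
   Context: For $u,w\in\mathbb Z^m$, $u\circ w$ is the componentwise product. An invertible matrix $A=(a_{ij})\in M_m(\mathbb Z)$ is in Hermite normal form if it is upper triangular and $0\le a_{ij}<a_{ii}$ for $1\le i<j\le m$. A subring matrix is an $m\times m$ invertible integer matrix in Hermite normal form whose column span $\operatorname{col}(A)$ contains $(1,\dots,1)^T$ and is closed under $\circ$ (equivalently, $\operatorname{col}(A)$ is a subring of $\mathbb Z^m$: a finite-index subgroup closed under $\circ$ containing $(1,\dots,1)$). An irreducible subring matrix is a subring matrix whose determinant is a power of $p$, whose last column is $(1,\dots,1)^T$, and all of whose entries in the first $m-1$ columns are divisible by $p$. -}

module Defs where

open import Data.Nat as ℕ using (ℕ; zero; suc)
open import Data.Integer as ℤ using (ℤ; +_; -_; _+_; _*_; _≤_; _<_; 0ℤ; 1ℤ)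
open import Data.Integer.Divisibility using (_∣_)
open import Data.Fin as Fin using (Fin; zero; suc; punchIn; inject₁; fromℕ; toℕ)
open import Data.Maybe using (Maybe; just; nothing)
import Data.Maybe as Maybe
open import Data.Product using (Σ; ∃; _×_; _,_)
open import Relation.Binary.PropositionalEquality using (_≡_; _≢_)

-- An m × m integer matrix: A i j is the entry in row i, column j.
Matrix : ℕ → Set
Matrix m = Fin m → Fin m → ℤ

Vect : ℕ → Set
Vect m = Fin m → ℤ

Σᶠ : ∀ {n} → (Fin n → ℤ) → ℤ
Σᶠ {zero}  f = 0ℤ
Σᶠ {suc n} f = f zero + Σᶠ (λ i → f (suc i))

_∘ᶜ_ : ∀ {m} → Vect m → Vect m → Vect m
(u ∘ᶜ w) i = u i * w i

𝟙 : ∀ {m} → Vect m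
𝟙 _ = 1ℤ

det : ∀ {m} → Matrix m → ℤ
det {zero}  A = 1ℤ
det {suc m} A = Σᶠ (λ j → sgn (toℕ j) * (A zero j * det (λ r c → A (suc r) (punchIn j c))))
  where
  sgn : ℕ → ℤ
  sgn zero          = 1ℤ
  sgn (suc zero)    = - 1ℤ
  sgn (suc (suc k)) = sgn k

InSpan : ∀ {m k} → Vect m → (Fin k → Vect m) → Set
InSpan {m} {k} v w = Σ (Fin k → ℤ) λ c → ∀ r → v r ≡ Σᶠ (λ t → c t * w t r)

col : ∀ {m} → Matrix m → Fin m → Vect m
col A j i = A i j

InColSpan : ∀ {m} → Vect m → Matrix m → Set
InColSpan v A = InSpan v (col A)

Invertible : ∀ {m} → Matrix m → Set
Invertible A = det A ≢ 0ℤ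

IsHNF : ∀ {m} → Matrix m → Set
IsHNF A = (∀ i j → j Fin.< i → A i j ≡ 0ℤ)
        × (∀ i j → i Fin.< j → (0ℤ ≤ A i j) × (A i j < A i i))

IsSubringMatrix : ∀ {m} → Matrix m → Set
IsSubringMatrix {m} A =
  Invertible A × IsHNF A × InColSpan 𝟙 A
  × (∀ (u w : Vect m) → InColSpan u A → InColSpan w A → InColSpan (u ∘ᶜ w) A)

IsIrreducibleSubringMatrix : ∀ {m} → ℕ → Matrix (suc m) → Set
IsIrreducibleSubringMatrix {m} p A =
  IsSubringMatrix A
  × (∃ λ e → det A ≡ + (p ℕ.^ e))
  × (∀ i → A i (fromℕ m) ≡ 1ℤ)
  × (∀ i (j : Fin m) → (+ p) ∣ A i (inject₁ j))

initOrLast : ∀ {k} → Fin (suc k) → Maybe (Fin k)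
initOrLast {zero}  zero    = nothing
initOrLast {suc k} zero    = just zero
initOrLast {suc k} (suc i) = Maybe.map suc (initOrLast i)

extendMatrix : ∀ {k} → Matrix k → Matrix (suc k)
extendMatrix B i j with initOrLast i | initOrLast j
... | _       | nothing = 1ℤ
... | nothing | just _  = 0ℤ
... | just r  | just t  = B r t

StrictlyIncreasing : ∀ {k m} → (Fin k → Fin m) → Set
StrictlyIncreasing ι = ∀ a b → a Fin.< b → ι a Fin.< ι b

{-# OPTIONS --safe #-}
-- A row s of A with A s s = 1 is a row of the identity matrix (Hermite normal form), so a vector
-- of col(A) vanishing on these unit rows is a combination of the non-unit columns v_ι; this gives
-- (1). For (4), if p ∣ A s s and p ∣ x_l for all l > s, then y = ∏_{l>s} (x - x_l 𝟙) ∈ col(A)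
-- vanishes beyond s, so A s s ∣ y_s by back substitution, and p ∣ x_s since p is prime; downward
-- induction over the rows then covers a whole non-unit column, and (3) is a special case. For (2),
-- the column span of the extended minor consists of the restrictions, to the rows ι and the last
-- row, of the vectors of col(A) that are constant on the unit rows; these form a subring, and the
-- minor is triangular with diagonal entries powers of p.
module Submission where

open import Defs
open import Data.Nat using (ℕ; suc; _^_)
open import Data.Nat.Primality using (Prime)
open import Data.Integer using (ℤ; +_; 1ℤ)
open import Data.Integer.Divisibility using (_∣_)
open import Data.Fin using (Fin; inject₁; fromℕ; _≤_)
open import Data.Product using (Σ; ∃; _×_; _,_)
open import Relation.Binary.PropositionalEquality using (_≡_; _≢_)
open import Function.Bundles using (_⇔_)

import Data.Integer.Properties as ℤP
open import Algebra.Properties.AbelianGroup ℤP.+-0-abelianGroup using (//-rightDividesˡ)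
open import Algebra.Properties.Semiring.Sum ℤP.+-*-semiring
  using (sum; ∑-distrib-+; *-distribˡ-sum; sum-init-last)
open import Data.Bool using (if_then_else_)
open import Data.Empty using (⊥-elim)
open import Data.Fin using (zero; suc; toℕ; punchIn; _<_)
open import Data.Fin.Induction using (>-wellFounded)
import Data.Fin.Properties as FinP
open import Data.Integer using (0ℤ; -1ℤ; _+_; _*_; -_; _-_)
import Data.Integer as ℤ
import Data.Integer.Divisibility.Signed as Signed
open import Data.Maybe using (just; nothing; maybe′)
open import Data.Nat using (zero)
import Data.Nat as ℕ
import Data.Nat.Divisibility as ℕ∣
open import Data.Nat.Primality using (euclidsLemma; ¬prime[1])
import Data.Nat.Properties as ℕP
open import Data.Product using (proj₁; proj₂)
open import Data.Sum using (_⊎_; inj₁; inj₂; [_,_]′)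
open import Function.Base using (_∘_; id)
open import Function.Bundles using (Equivalence)
open import Induction.WellFounded using (module All)
open import Relation.Binary.Definitions using (tri<; tri≈; tri>)
open import Relation.Binary.PropositionalEquality
  using (refl; sym; trans; cong; cong₂; subst; subst₂; module ≡-Reasoning)
open import Relation.Nullary using (¬_; Dec; yes; no; does)

Σᶠ≡sum : ∀ {n} (f : Fin n → ℤ) → Σᶠ f ≡ sum f
Σᶠ≡sum {zero}  f = refl
Σᶠ≡sum {suc n} f = cong (λ s → f zero + s) (Σᶠ≡sum (f ∘ suc))

Σᶠ-cong : ∀ {n} {f g : Fin n → ℤ} → (∀ t → f t ≡ g t) → Σᶠ f ≡ Σᶠ g
Σᶠ-cong {zero}  _   = refl
Σᶠ-cong {suc n} f≗g = cong₂ _+_ (f≗g zero) (Σᶠ-cong (f≗g ∘ suc))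

Σᶠ-zero : ∀ {n} {f : Fin n → ℤ} → (∀ t → f t ≡ 0ℤ) → Σᶠ f ≡ 0ℤ
Σᶠ-zero {zero}  _   = refl
Σᶠ-zero {suc n} f≗0 = cong₂ _+_ (f≗0 zero) (Σᶠ-zero (f≗0 ∘ suc))

Σᶠ-single : ∀ {n} (f : Fin n → ℤ) j → (∀ t → t ≢ j → f t ≡ 0ℤ) → Σᶠ f ≡ f j
Σᶠ-single f zero    off =
  trans (cong (λ s → f zero + s) (Σᶠ-zero λ t → off (suc t) λ ())) (ℤP.+-identityʳ _)
Σᶠ-single f (suc j) off =
  trans (cong (_+ Σᶠ (f ∘ suc)) (off zero λ ()))
        (trans (ℤP.+-identityˡ _)
               (Σᶠ-single (f ∘ suc) j λ t t≢j → off (suc t) (t≢j ∘ FinP.suc-injective)))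

Σᶠ-distrib-+ : ∀ {n} (f g : Fin n → ℤ) → Σᶠ (λ t → f t + g t) ≡ Σᶠ f + Σᶠ g
Σᶠ-distrib-+ f g =
  trans (Σᶠ≡sum (λ t → f t + g t)) (trans (∑-distrib-+ f g) (sym (cong₂ _+_ (Σᶠ≡sum f) (Σᶠ≡sum g))))

*-distribˡ-Σᶠ : ∀ {n} a (f : Fin n → ℤ) → a * Σᶠ f ≡ Σᶠ (λ t → a * f t)
*-distribˡ-Σᶠ a f =
  trans (cong (a *_) (Σᶠ≡sum f)) (trans (*-distribˡ-sum a f) (sym (Σᶠ≡sum (λ t → a * f t))))

Σᶠ-init-last : ∀ {n} (f : Fin (suc n) → ℤ) → Σᶠ f ≡ Σᶠ (f ∘ inject₁) + f (fromℕ n)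
Σᶠ-init-last {n} f =
  trans (Σᶠ≡sum f) (trans (sum-init-last f) (cong (_+ f (fromℕ n)) (sym (Σᶠ≡sum (f ∘ inject₁)))))

Πᶠ : ∀ {n} → (Fin n → ℤ) → ℤ
Πᶠ {zero}  f = 1ℤ
Πᶠ {suc n} f = f zero * Πᶠ (f ∘ suc)

Πᶠ-zero : ∀ {n} (f : Fin n → ℤ) j → f j ≡ 0ℤ → Πᶠ f ≡ 0ℤ
Πᶠ-zero f zero    fj≡0 = cong (_* Πᶠ (f ∘ suc)) fj≡0
Πᶠ-zero f (suc j) fj≡0 = trans (cong (f zero *_) (Πᶠ-zero (f ∘ suc) j fj≡0)) (ℤP.*-zeroʳ (f zero))

Πᶠ-nonzero : ∀ {n} {f : Fin n → ℤ} → (∀ i → f i ≢ 0ℤ) → Πᶠ f ≢ 0ℤ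
Πᶠ-nonzero {zero}  _   ()
Πᶠ-nonzero {suc n} f≢0 Πf≡0 = [ f≢0 zero , Πᶠ-nonzero (f≢0 ∘ suc) ]′ (ℤP.i*j≡0⇒i≡0∨j≡0 _ Πf≡0)

IsPowerOf : ℕ → ℤ → Set
IsPowerOf p z = ∃ λ e → z ≡ + (p ^ e)

IsPowerOf-* : ∀ {p x y} → IsPowerOf p x → IsPowerOf p y → IsPowerOf p (x * y)
IsPowerOf-* {p} (e , refl) (f , refl) =
  e ℕ.+ f , trans (sym (ℤP.pos-* (p ^ e) (p ^ f))) (cong +_ (sym (ℕP.^-distribˡ-+-* p e f)))

Πᶠ-IsPowerOf : ∀ {p n} {f : Fin n → ℤ} → (∀ i → IsPowerOf p (f i)) → IsPowerOf p (Πᶠ f)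
Πᶠ-IsPowerOf {n = zero}  _     = 0 , refl
Πᶠ-IsPowerOf {n = suc n} powers = IsPowerOf-* (powers zero) (Πᶠ-IsPowerOf (powers ∘ suc))

∣m-n∣n⇒∣m : ∀ {k m n} → k ∣ m - n → k ∣ n → k ∣ m
∣m-n∣n⇒∣m {k} {m} {n} k∣m-n k∣n =
  Signed.∣⇒∣ᵤ (Signed.∣m+n∣n⇒∣m {k} {m} (Signed.∣ᵤ⇒∣ {k} {m - n} k∣m-n)
                                       (Signed.∣m⇒∣-m (Signed.∣ᵤ⇒∣ {k} {n} k∣n)))

module _ {p} (p-prime : Prime p) where

  p∤1 : ¬ (+ p) ∣ 1ℤ
  p∤1 p∣1 = ¬prime[1] (subst Prime (ℕ∣.∣1⇒≡1 p∣1) p-prime)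

  p^e≡1⇒e≡0 : ∀ {e} → + (p ^ e) ≡ 1ℤ → e ≡ 0
  p^e≡1⇒e≡0 {e} p^e≡1 =
    [ id , (λ p≡1 → ⊥-elim (¬prime[1] (subst Prime p≡1 p-prime))) ]′
      (ℕP.m^n≡1⇒n≡0∨m≡1 p e (ℤP.+-injective p^e≡1))

  IsPowerOf⇒≡1⊎∣ : ∀ {x} → IsPowerOf p x → x ≡ 1ℤ ⊎ (+ p) ∣ x
  IsPowerOf⇒≡1⊎∣ (zero  , x≡1)   = inj₁ x≡1
  IsPowerOf⇒≡1⊎∣ (suc e , x≡p^e) = inj₂ (subst ((+ p) ∣_) (sym x≡p^e) (ℕ∣.m∣m*n (p ^ e)))

  prime-∣-* : ∀ a b → (+ p) ∣ a * b → (+ p) ∣ a ⊎ (+ p) ∣ b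
  prime-∣-* a b p∣ab = euclidsLemma ℤ.∣ a ∣ ℤ.∣ b ∣ p-prime (subst (p ℕ∣.∣_) (ℤP.abs-* a b) p∣ab)

  prime-∣-Πᶠ : ∀ {n} (f : Fin n → ℤ) → (+ p) ∣ Πᶠ f → ∃ λ i → (+ p) ∣ f i
  prime-∣-Πᶠ {zero}  f p∣1   = ⊥-elim (p∤1 p∣1)
  prime-∣-Πᶠ {suc n} f p∣Πf with prime-∣-* (f zero) (Πᶠ (f ∘ suc)) p∣Πf
  ... | inj₁ p∣f₀ = zero , p∣f₀
  ... | inj₂ p∣Πf′ with prime-∣-Πᶠ (f ∘ suc) p∣Πf′
  ...   | i , p∣fi = suc i , p∣fi

data InnerOrLast {k} : Fin (suc k) → Set where
  inner : (r : Fin k) → InnerOrLast (inject₁ r)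
  last  : InnerOrLast (fromℕ k)

innerOrLast : ∀ {k} (i : Fin (suc k)) → InnerOrLast i
innerOrLast {zero}  zero    = last
innerOrLast {suc k} zero    = inner zero
innerOrLast {suc k} (suc i) with innerOrLast i
... | inner r = inner (suc r)
... | last    = last

initOrLast-inject₁ : ∀ {k} (r : Fin k) → initOrLast (inject₁ r) ≡ just r
initOrLast-inject₁ {suc k} zero    = refl
initOrLast-inject₁ {suc k} (suc r) = cong (maybe′ (just ∘ suc) nothing) (initOrLast-inject₁ r)

initOrLast-fromℕ : ∀ k → initOrLast (fromℕ k) ≡ nothing
initOrLast-fromℕ zero    = refl
initOrLast-fromℕ (suc k) = cong (maybe′ (just ∘ suc) nothing) (initOrLast-fromℕ k)

inject₁-<-mono : ∀ {k} {a b : Fin k} → a < b → inject₁ a < inject₁ b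
inject₁-<-mono {a = a} {b} = subst₂ ℕ._<_ (sym (FinP.toℕ-inject₁ a)) (sym (FinP.toℕ-inject₁ b))

inject₁-<-cancel : ∀ {k} {a b : Fin k} → inject₁ a < inject₁ b → a < b
inject₁-<-cancel {a = a} {b} = subst₂ ℕ._<_ (FinP.toℕ-inject₁ a) (FinP.toℕ-inject₁ b)

fromℕ≮ : ∀ {k} (i : Fin (suc k)) → ¬ fromℕ k < i
fromℕ≮ i fromℕ<i = ℕP.<⇒≱ fromℕ<i (FinP.≤fromℕ i)

module _ {k} (C : Matrix k) where

  extendMatrix-inner : ∀ r t → extendMatrix C (inject₁ r) (inject₁ t) ≡ C r t
  extendMatrix-inner r t rewrite initOrLast-inject₁ r | initOrLast-inject₁ t = refl

  extendMatrix-lastCol : ∀ i → extendMatrix C i (fromℕ k) ≡ 1ℤ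
  extendMatrix-lastCol i rewrite initOrLast-fromℕ k with initOrLast i
  ... | just _  = refl
  ... | nothing = refl

  extendMatrix-lastRow : ∀ t → extendMatrix C (fromℕ k) (inject₁ t) ≡ 0ℤ
  extendMatrix-lastRow t rewrite initOrLast-fromℕ k | initOrLast-inject₁ t = refl

module _ {n k} {w : Fin k → Vect n} where

  InSpan-resp : ∀ {u v} → (∀ r → u r ≡ v r) → InSpan u w → InSpan v w
  InSpan-resp u≗v (c , u≡) = c , λ r → trans (sym (u≗v r)) (u≡ r)

  InSpan-zero : InSpan (λ _ → 0ℤ) w
  InSpan-zero = (λ _ → 0ℤ) , λ _ → sym (Σᶠ-zero {k} λ _ → refl)

  InSpan-+ : ∀ {u v} → InSpan u w → InSpan v w → InSpan (λ r → u r + v r) w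
  InSpan-+ {u} {v} (c , u≡) (d , v≡) = (λ t → c t + d t) , λ r → begin
    u r + v r
      ≡⟨ cong₂ _+_ (u≡ r) (v≡ r) ⟩
    Σᶠ (λ t → c t * w t r) + Σᶠ (λ t → d t * w t r)
      ≡⟨ Σᶠ-distrib-+ (λ t → c t * w t r) (λ t → d t * w t r) ⟨
    Σᶠ (λ t → c t * w t r + d t * w t r)
      ≡⟨ Σᶠ-cong (λ t → ℤP.*-distribʳ-+ (w t r) (c t) (d t)) ⟨
    Σᶠ (λ t → (c t + d t) * w t r) ∎
    where open ≡-Reasoning

  InSpan-* : ∀ a {u} → InSpan u w → InSpan (λ r → a * u r) w
  InSpan-* a {u} (c , u≡) = (λ t → a * c t) , λ r → begin
    a * u r                          ≡⟨ cong (a *_) (u≡ r) ⟩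
    a * Σᶠ (λ t → c t * w t r)       ≡⟨ *-distribˡ-Σᶠ a (λ t → c t * w t r) ⟩
    Σᶠ (λ t → a * (c t * w t r))     ≡⟨ Σᶠ-cong (λ t → ℤP.*-assoc a (c t) (w t r)) ⟨
    Σᶠ (λ t → a * c t * w t r)       ∎
    where open ≡-Reasoning

  InSpan-member : ∀ j → InSpan (w j) w
  InSpan-member j = δ , λ r → sym (trans (Σᶠ-single _ j (off r)) (on r (j FinP.≟ j)))
    where
    δ : Fin k → ℤ
    δ t = if does (t FinP.≟ j) then 1ℤ else 0ℤ
    off : ∀ r t → t ≢ j → δ t * w t r ≡ 0ℤ
    off r t t≢j with t FinP.≟ j
    ... | yes t≡j = ⊥-elim (t≢j t≡j)
    ... | no _    = refl
    on : ∀ r d → (if does d then 1ℤ else 0ℤ) * w j r ≡ w j r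
    on r (yes _)  = ℤP.*-identityˡ (w j r)
    on r (no j≢j) = ⊥-elim (j≢j refl)

  InSpan-Σᶠ : ∀ {l} (F : Fin l → Vect n) → (∀ s → InSpan (F s) w) → InSpan (λ r → Σᶠ (λ s → F s r)) w
  InSpan-Σᶠ {zero}  F _   = InSpan-zero
  InSpan-Σᶠ {suc l} F F∈ = InSpan-+ (F∈ zero) (InSpan-Σᶠ (F ∘ suc) (F∈ ∘ suc))

  InSpan-lincomb : ∀ {l} (c : Fin l → ℤ) (v : Fin l → Vect n) → (∀ s → InSpan (v s) w)
    → InSpan (λ r → Σᶠ (λ s → c s * v s r)) w
  InSpan-lincomb c v v∈ = InSpan-Σᶠ _ (λ s → InSpan-* (c s) (v∈ s))

  InSpan-subfamily : ∀ {l u} (ι : Fin l → Fin k) → InSpan u (w ∘ ι) → InSpan u w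
  InSpan-subfamily ι (c , u≡) = InSpan-resp (sym ∘ u≡) (InSpan-lincomb c (w ∘ ι) (InSpan-member ∘ ι))

InSpan-restrict : ∀ {n k l} {w : Fin k → Vect n} {u} (ι : Fin l → Fin k) (u∈ : InSpan u w)
  → (∀ s → (∀ t → ι t ≢ s) → proj₁ u∈ s ≡ 0ℤ) → InSpan u (w ∘ ι)
InSpan-restrict {w = w} ι (c , u≡) c-off = InSpan-resp (sym ∘ u≡) (InSpan-Σᶠ _ term∈)
  where
  term∈ : ∀ s → InSpan (λ r → c s * w s r) (w ∘ ι)
  term∈ s with FinP.any? (λ t → ι t FinP.≟ s)
  ... | yes (t , refl) = InSpan-* (c s) (InSpan-member t)
  ... | no s∉ι = InSpan-resp (λ r → sym (cong (_* w s r) (c-off s λ t ιt≡s → s∉ι (t , ιt≡s)))) InSpan-zero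

laplace-first-row : ∀ {k} (M : Matrix (suc k)) → Σ (Fin k → ℤ) λ tail →
  det M ≡ 1ℤ * (M zero zero * det (λ r c → M (suc r) (suc c))) + Σᶠ tail
laplace-first-row M = _ , refl

parity-ind : (P : ℕ → Set) → P 0 → P 1 → (∀ n → P n → P (suc (suc n))) → ∀ n → P n
parity-ind P p₀ p₁ step zero          = p₀
parity-ind P p₀ p₁ step (suc zero)    = p₁
parity-ind P p₀ p₁ step (suc (suc n)) = step n (parity-ind P p₀ p₁ step n)

-- The sign of a Laplace term is local to the definition of det and cannot be named, so the terms
-- are named as a whole above; generalising over toℕ t lets a parity induction with an inferred
-- motive evaluate the sign to -1 or 1.
laplace-tail-zero : ∀ {k} (M : Matrix (suc k)) t →
  M zero (suc t) * det (λ r c → M (suc r) (punchIn (suc t) c)) ≡ 0ℤ → proj₁ (laplace-first-row M) t ≡ 0ℤ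
laplace-tail-zero M t term≡0
  with toℕ t | parity-ind _ (cong (-1ℤ *_) term≡0) (cong (1ℤ *_) term≡0) (λ _ h → h)
... | n | signed-term≡0 = signed-term≡0 n

mutual
  det-expand-firstCol : ∀ {k} (M : Matrix (suc k)) → (∀ r → M (suc r) zero ≡ 0ℤ)
    → det M ≡ M zero zero * det (λ r c → M (suc r) (suc c))
  det-expand-firstCol M col₀ =
    trans (proj₂ (laplace-first-row M))
          (trans (cong (λ s → 1ℤ * leading + s) (Σᶠ-zero tail≡0))
                 (trans (ℤP.+-identityʳ (1ℤ * leading)) (ℤP.*-identityˡ leading)))
    where
    leading : ℤ
    leading = M zero zero * det (λ r c → M (suc r) (suc c))
    tail≡0 : ∀ t → proj₁ (laplace-first-row M) t ≡ 0ℤ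
    tail≡0 t = laplace-tail-zero M t
      (trans (cong (M zero (suc t) *_) (det-minor-firstCol-zero M t col₀)) (ℤP.*-zeroʳ (M zero (suc t))))

  det-minor-firstCol-zero : ∀ {k} (M : Matrix (suc k)) (t : Fin k) → (∀ r → M (suc r) zero ≡ 0ℤ)
    → det (λ r c → M (suc r) (punchIn (suc t) c)) ≡ 0ℤ
  det-minor-firstCol-zero {suc k} M t col₀ =
    trans (det-expand-firstCol (λ r c → M (suc r) (punchIn (suc t) c)) (col₀ ∘ suc))
          (cong (_* det (λ r c → M (suc (suc r)) (punchIn (suc t) (suc c)))) (col₀ zero))

det-upperTriangular : ∀ {k} (M : Matrix k) → (∀ i j → j < i → M i j ≡ 0ℤ) → det M ≡ Πᶠ (λ i → M i i)
det-upperTriangular {zero}  M _     = refl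
det-upperTriangular {suc k} M lower =
  trans (det-expand-firstCol M (λ r → lower (suc r) zero ℕ.z<s))
        (cong (M zero zero *_) (det-upperTriangular _ (λ i j j<i → lower (suc i) (suc j) (ℕ.s<s j<i))))

module _ {n} {A : Matrix n} (hnf : IsHNF A) where

  private
    lower : ∀ i j → j < i → A i j ≡ 0ℤ
    lower = proj₁ hnf
    upper : ∀ i j → i < j → (0ℤ ℤ.≤ A i j) × (A i j ℤ.< A i i)
    upper = proj₂ hnf

  unit-row : ∀ {s} → A s s ≡ 1ℤ → ∀ t → t ≢ s → A s t ≡ 0ℤ
  unit-row {s} Ass≡1 t t≢s with FinP.<-cmp s t
  ... | tri< s<t _ _ = ℤP.≤-antisym (ℤP.i<j⇒i≤pred[j] (subst (A s t ℤ.<_) Ass≡1 (proj₂ (upper s t s<t))))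
                                    (proj₁ (upper s t s<t))
  ... | tri≈ _ s≡t _ = ⊥-elim (t≢s (sym s≡t))
  ... | tri> _ _ t<s = lower s t t<s

  colSpan-at-unit-row : ∀ {s z} (z∈ : InColSpan z A) → A s s ≡ 1ℤ → z s ≡ proj₁ z∈ s
  colSpan-at-unit-row {s} {z} (c , z≡) Ass≡1 = begin
    z s                      ≡⟨ z≡ s ⟩
    Σᶠ (λ t → c t * A s t)   ≡⟨ Σᶠ-single (λ t → c t * A s t) s off ⟩
    c s * A s s              ≡⟨ cong (c s *_) Ass≡1 ⟩
    c s * 1ℤ                 ≡⟨ ℤP.*-identityʳ (c s) ⟩
    c s                      ∎
    where
    open ≡-Reasoning
    off : ∀ t → t ≢ s → c t * A s t ≡ 0ℤ
    off t t≢s = trans (cong (c t *_) (unit-row Ass≡1 t t≢s)) (ℤP.*-zeroʳ (c t))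

  1<nonunit-pivot : ∀ {i j} → i < j → A i i ≢ 1ℤ → 1ℤ ℤ.< A i i
  1<nonunit-pivot {i} {j} i<j Aii≢1 =
    ℤP.≤∧≢⇒< (ℤP.i<j⇒suc[i]≤j (ℤP.≤-<-trans (proj₁ (upper i j i<j)) (proj₂ (upper i j i<j)))) (Aii≢1 ∘ sym)

  row-expansion-upper : ∀ (c : Fin n → ℤ) l → (∀ t → l < t → c t ≡ 0ℤ)
    → Σᶠ (λ t → c t * A l t) ≡ c l * A l l
  row-expansion-upper c l c-beyond = Σᶠ-single (λ t → c t * A l t) l off
    where
    off : ∀ t → t ≢ l → c t * A l t ≡ 0ℤ
    off t t≢l with FinP.<-cmp t l
    ... | tri< t<l _ _ = trans (cong (c t *_) (lower l t t<l)) (ℤP.*-zeroʳ (c t))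
    ... | tri≈ _ t≡l _ = ⊥-elim (t≢l t≡l)
    ... | tri> _ _ l<t = cong (_* A l t) (c-beyond t l<t)

  -- Back substitution: the coefficients of y beyond s vanish.
  pivot-∣-entry : (∀ l → A l l ≢ 0ℤ) → ∀ {y} → InColSpan y A → ∀ s → (∀ l → s < l → y l ≡ 0ℤ)
    → A s s ∣ y s
  pivot-∣-entry pivot≢0 {y} (c , y≡) s y-beyond =
    Signed.∣⇒∣ᵤ (Signed.divides (c s) (trans (y≡ s) (row-expansion-upper c s c-beyond)))
    where
    step : ∀ l → (∀ {t} → l < t → s < t → c t ≡ 0ℤ) → s < l → c l ≡ 0ℤ
    step l c-beyond-l s<l = [ id , ⊥-elim ∘ pivot≢0 l ]′ (ℤP.i*j≡0⇒i≡0∨j≡0 (c l) (begin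
      c l * A l l
        ≡⟨ row-expansion-upper c l (λ t l<t → c-beyond-l l<t (FinP.<-trans s<l l<t)) ⟨
      Σᶠ (λ t → c t * A l t)
        ≡⟨ y≡ l ⟨
      y l
        ≡⟨ y-beyond l s<l ⟩
      0ℤ ∎))
      where open ≡-Reasoning
    c-beyond : ∀ l → s < l → c l ≡ 0ℤ
    c-beyond = All.wfRec >-wellFounded _ (λ l → s < l → c l ≡ 0ℤ) step

module _ {n} {A : Matrix n} (sub : IsSubringMatrix A) where

  isHNF : IsHNF A
  isHNF = proj₁ (proj₂ sub)

  𝟙∈colSpan : InColSpan 𝟙 A
  𝟙∈colSpan = proj₁ (proj₂ (proj₂ sub))

  colSpan-∘-closed : ∀ (u w : Vect n) → InColSpan u A → InColSpan w A → InColSpan (u ∘ᶜ w) A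
  colSpan-∘-closed = proj₂ (proj₂ (proj₂ sub))

  pivot≢0 : ∀ s → A s s ≢ 0ℤ
  pivot≢0 s Ass≡0 =
    proj₁ sub (trans (det-upperTriangular A (proj₁ isHNF)) (Πᶠ-zero (λ i → A i i) s Ass≡0))

  InColSpan-const : ∀ q → InColSpan (λ _ → q) A
  InColSpan-const q = InSpan-resp (λ _ → ℤP.*-identityʳ q) (InSpan-* q 𝟙∈colSpan)

  InColSpan-shift : ∀ {x} → InColSpan x A → ∀ q → InColSpan (λ r → x r - q) A
  InColSpan-shift x∈ q = InSpan-+ x∈ (InColSpan-const (- q))

  InColSpan-Πᶠ : ∀ {l} (G : Fin l → Vect n) → (∀ i → InColSpan (G i) A)
    → InColSpan (λ r → Πᶠ (λ i → G i r)) A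
  InColSpan-Πᶠ {zero}  G _  = 𝟙∈colSpan
  InColSpan-Πᶠ {suc l} G G∈ = colSpan-∘-closed (G zero) _ (G∈ zero) (InColSpan-Πᶠ (G ∘ suc) (G∈ ∘ suc))

  module _ {p} (p-prime : Prime p) where

    prime-∣-at-pivot-row : ∀ {x} → InColSpan x A → ∀ s → (+ p) ∣ A s s → (∀ l → s < l → (+ p) ∣ x l)
      → (+ p) ∣ x s
    prime-∣-at-pivot-row {x} x∈ s p∣Ass p∣beyond = conclude (prime-∣-Πᶠ p-prime (λ l → factor l s) p∣ys)
      where
      factor-if : ∀ {P : Set} → Dec P → ℤ → ℤ
      factor-if (yes _) z = z
      factor-if (no _)  _ = 1ℤ
      factor : Fin n → Vect n
      factor l r = factor-if (s FinP.<? l) (x r - x l)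
      factor∈ : ∀ l → InColSpan (factor l) A
      factor∈ l with s FinP.<? l
      ... | yes _ = InColSpan-shift x∈ (x l)
      ... | no _  = 𝟙∈colSpan
      factor-diag : ∀ l → s < l → factor l l ≡ 0ℤ
      factor-diag l s<l with s FinP.<? l
      ... | yes _  = ℤP.+-inverseʳ (x l)
      ... | no s≮l = ⊥-elim (s≮l s<l)
      p∣ys : (+ p) ∣ Πᶠ (λ l → factor l s)
      p∣ys = ℕ∣.∣-trans p∣Ass (pivot-∣-entry isHNF pivot≢0 (InColSpan-Πᶠ factor factor∈) s
               (λ l s<l → Πᶠ-zero (λ i → factor i l) l (factor-diag l s<l)))
      conclude : (∃ λ l → (+ p) ∣ factor l s) → (+ p) ∣ x s
      conclude (l , p∣factor) with s FinP.<? l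
      ... | yes s<l = ∣m-n∣n⇒∣m {+ p} {x s} {x l} p∣factor (p∣beyond l s<l)
      ... | no _    = ⊥-elim (p∤1 p-prime p∣factor)

    prime-∣-colSpan : (∀ s → IsPowerOf p (A s s)) → ∀ {x} → InColSpan x A
      → (∀ s → A s s ≡ 1ℤ → (+ p) ∣ x s) → ∀ r → (+ p) ∣ x r
    prime-∣-colSpan pivots {x} x∈ p∣units = All.wfRec >-wellFounded _ (λ r → (+ p) ∣ x r) step
      where
      step : ∀ r → (∀ {l} → r < l → (+ p) ∣ x l) → (+ p) ∣ x r
      step r p∣beyond with IsPowerOf⇒≡1⊎∣ p-prime (pivots r)
      ... | inj₁ Arr≡1 = p∣units r Arr≡1
      ... | inj₂ p∣Arr = prime-∣-at-pivot-row x∈ r p∣Arr (λ l → p∣beyond {l})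

    prime-∣-column : (∀ s → IsPowerOf p (A s s)) → ∀ {i} → (+ p) ∣ A i i → ∀ r → (+ p) ∣ A r i
    prime-∣-column pivots {i} p∣Aii = prime-∣-colSpan pivots (InSpan-member i) p∣unit-rows
      where
      p∣unit-rows : ∀ s → A s s ≡ 1ℤ → (+ p) ∣ A s i
      p∣unit-rows s Ass≡1 = subst ((+ p) ∣_) (sym (unit-row isHNF Ass≡1 i i≢s)) (p ℕ∣.∣0)
        where
        i≢s : i ≢ s
        i≢s refl = p∤1 p-prime (subst ((+ p) ∣_) Ass≡1 p∣Aii)

module NonUnitMinor {m k} {A : Matrix (suc m)} (sub : IsSubringMatrix A)
  (last-unit : A (fromℕ m) (fromℕ m) ≡ 1ℤ)
  {ι : Fin k → Fin (suc m)} (ι-mono : StrictlyIncreasing ι)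
  (ι-nonunit : ∀ t → A (ι t) (ι t) ≢ 1ℤ)
  (off-ι-unit : ∀ s → (∀ t → ι t ≢ s) → A s s ≡ 1ℤ)
  where

  ι-avoids-units : ∀ {s} → A s s ≡ 1ℤ → ∀ t → ι t ≢ s
  ι-avoids-units Ass≡1 t refl = ι-nonunit t Ass≡1

  -- Unit rows are rows of the identity, so there z shows its coefficients, which hence vanish off ι.
  colSpan-vanishing-on-units : ∀ {z} → InColSpan z A → (∀ s → A s s ≡ 1ℤ → z s ≡ 0ℤ)
    → InSpan z (col A ∘ ι)
  colSpan-vanishing-on-units z∈ z-units = InSpan-restrict {w = col A} ι z∈ λ s s∉ι →
    trans (sym (colSpan-at-unit-row (isHNF sub) z∈ (off-ι-unit s s∉ι))) (z-units s (off-ι-unit s s∉ι))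

  ι-product-span : ∀ a b → InSpan (col A (ι a) ∘ᶜ col A (ι b)) (col A ∘ ι)
  ι-product-span a b = colSpan-vanishing-on-units
    (colSpan-∘-closed sub _ _ (InSpan-member {w = col A} (ι a)) (InSpan-member {w = col A} (ι b)))
    (λ s Ass≡1 → cong (_* A s (ι b)) (unit-row (isHNF sub) Ass≡1 (ι a) (ι-avoids-units Ass≡1 a)))

  ι<fromℕ : ∀ t → ι t < fromℕ m
  ι<fromℕ t = FinP.≤∧≢⇒< (FinP.≤fromℕ (ι t)) (ι-avoids-units last-unit t)

  minor : Matrix (suc k)
  minor = extendMatrix (λ r t → A (ι r) (ι t))

  -- Row i of the minor is taken from row ρ i of A; the appended zero row matches the unit last row.
  ρ : Fin (suc k) → Fin (suc m)
  ρ i = maybe′ ι (fromℕ m) (initOrLast i)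

  ρ-inject₁ : ∀ r → ρ (inject₁ r) ≡ ι r
  ρ-inject₁ r = cong (maybe′ ι (fromℕ m)) (initOrLast-inject₁ r)

  ρ-fromℕ : ρ (fromℕ k) ≡ fromℕ m
  ρ-fromℕ = cong (maybe′ ι (fromℕ m)) (initOrLast-fromℕ k)

  ρ-mono : StrictlyIncreasing ρ
  ρ-mono i j i<j with innerOrLast i | innerOrLast j
  ... | inner r | inner t =
    subst₂ _<_ (sym (ρ-inject₁ r)) (sym (ρ-inject₁ t)) (ι-mono r t (inject₁-<-cancel i<j))
  ... | inner r | last    = subst₂ _<_ (sym (ρ-inject₁ r)) (sym ρ-fromℕ) (ι<fromℕ r)
  ... | last    | _       = ⊥-elim (fromℕ≮ j i<j)

  minor-lastCol : ∀ i → minor i (fromℕ k) ≡ 1ℤ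
  minor-lastCol = extendMatrix-lastCol _

  minor-innerCol : ∀ i t → minor i (inject₁ t) ≡ A (ρ i) (ι t)
  minor-innerCol i t with innerOrLast i
  ... | inner r = trans (extendMatrix-inner _ r t) (cong (λ s → A s (ι t)) (sym (ρ-inject₁ r)))
  ... | last    = trans (extendMatrix-lastRow _ t)
                    (sym (trans (cong (λ s → A s (ι t)) ρ-fromℕ)
                                (unit-row (isHNF sub) last-unit (ι t) (ι-avoids-units last-unit t))))

  minor-diag : ∀ i → minor i i ≡ A (ρ i) (ρ i)
  minor-diag i with innerOrLast i
  ... | inner r = trans (minor-innerCol (inject₁ r) r) (cong (A (ρ (inject₁ r))) (sym (ρ-inject₁ r)))
  ... | last    = trans (minor-lastCol (fromℕ k)) (sym (trans (cong (λ s → A s s) ρ-fromℕ) last-unit))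

  minor-lower : ∀ i j → j < i → minor i j ≡ 0ℤ
  minor-lower i j j<i with innerOrLast j
  ... | inner t = trans (minor-innerCol i t)
                    (proj₁ (isHNF sub) (ρ i) (ι t) (subst (_< ρ i) (ρ-inject₁ t) (ρ-mono _ _ j<i)))
  ... | last    = ⊥-elim (fromℕ≮ i j<i)

  minor-upper : ∀ i j → i < j → (0ℤ ℤ.≤ minor i j) × (minor i j ℤ.< minor i i)
  minor-upper i j i<j with innerOrLast j
  ... | inner t = subst₂ (λ a b → (0ℤ ℤ.≤ a) × (a ℤ.< b)) (sym (minor-innerCol i t)) (sym (minor-diag i))
                    (proj₂ (isHNF sub) (ρ i) (ι t) (subst (ρ i <_) (ρ-inject₁ t) (ρ-mono _ _ i<j)))
  ... | last with innerOrLast i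
  ...   | inner r = subst₂ (λ a b → (0ℤ ℤ.≤ a) × (a ℤ.< b))
                      (sym (minor-lastCol (inject₁ r))) (sym (extendMatrix-inner _ r r))
                      (ℤ.+≤+ ℕ.z≤n , 1<nonunit-pivot (isHNF sub) (ι<fromℕ r) (ι-nonunit r))
  ...   | last    = ⊥-elim (FinP.<-irrefl refl i<j)

  minor-invertible : Invertible minor
  minor-invertible det≡0 =
    Πᶠ-nonzero (λ i mii≡0 → pivot≢0 sub (ρ i) (trans (sym (minor-diag i)) mii≡0))
               (trans (sym (det-upperTriangular minor minor-lower)) det≡0)

  UnitConstant : Vect (suc m) → Set
  UnitConstant x = ∃ λ q → ∀ s → A s s ≡ 1ℤ → x s ≡ q

  restrict-colSpan : ∀ {x} → InColSpan x A → UnitConstant x → InColSpan (x ∘ ρ) minor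
  restrict-colSpan {x} x∈ (q , x-units) =
    InSpan-resp {w = col minor} restricts (InSpan-+ {w = col minor} inner∈ last∈)
    where
    x-q∈ : InSpan (λ r → x r - q) (col A ∘ ι)
    x-q∈ = colSpan-vanishing-on-units (InColSpan-shift sub x∈ q)
             (λ s Ass≡1 → trans (cong (λ v → v - q) (x-units s Ass≡1)) (ℤP.+-inverseʳ q))
    d : Fin k → ℤ
    d = proj₁ x-q∈
    inner∈ : InColSpan (λ i → Σᶠ (λ t → d t * minor i (inject₁ t))) minor
    inner∈ = InSpan-subfamily {w = col minor} inject₁ (d , λ _ → refl)
    last∈ : InColSpan (λ i → q * minor i (fromℕ k)) minor
    last∈ = InSpan-* {w = col minor} q (InSpan-member {w = col minor} (fromℕ k))
    open ≡-Reasoning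
    restricts : ∀ i → Σᶠ (λ t → d t * minor i (inject₁ t)) + q * minor i (fromℕ k) ≡ x (ρ i)
    restricts i = begin
      Σᶠ (λ t → d t * minor i (inject₁ t)) + q * minor i (fromℕ k)
        ≡⟨ cong₂ _+_ (Σᶠ-cong λ t → cong (d t *_) (minor-innerCol i t))
                     (trans (cong (q *_) (minor-lastCol i)) (ℤP.*-identityʳ q)) ⟩
      Σᶠ (λ t → d t * A (ρ i) (ι t)) + q
        ≡⟨ cong (_+ q) (proj₂ x-q∈ (ρ i)) ⟨
      x (ρ i) - q + q
        ≡⟨ //-rightDividesˡ q (x (ρ i)) ⟩
      x (ρ i) ∎

  UnitConstant-∘ : ∀ {x y} → UnitConstant x → UnitConstant y → UnitConstant (x ∘ᶜ y)
  UnitConstant-∘ (q , x-units) (q′ , y-units) =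
    q * q′ , λ s Ass≡1 → cong₂ _*_ (x-units s Ass≡1) (y-units s Ass≡1)

  record Lift (u : Vect (suc k)) : Set where
    field
      vec          : Vect (suc m)
      vec∈         : InColSpan vec A
      unitConstant : UnitConstant vec
      restricts    : ∀ i → u i ≡ vec (ρ i)

  colSpan-lift : ∀ {u} → InColSpan u minor → Lift u
  colSpan-lift {u} (c , u≡) = record
    { vec = x ; vec∈ = x∈ ; unitConstant = c (fromℕ k) , x-units ; restricts = u≗x∘ρ }
    where
    x : Vect (suc m)
    x r = Σᶠ (λ t → c (inject₁ t) * A r (ι t)) + c (fromℕ k)
    x∈ : InColSpan x A
    x∈ = InSpan-+ {w = col A}
           (InSpan-lincomb {w = col A} (c ∘ inject₁) (col A ∘ ι) (λ t → InSpan-member {w = col A} (ι t)))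
           (InColSpan-const sub (c (fromℕ k)))
    x-units : ∀ s → A s s ≡ 1ℤ → x s ≡ c (fromℕ k)
    x-units s Ass≡1 = trans (cong (_+ c (fromℕ k)) (Σᶠ-zero λ t →
        trans (cong (c (inject₁ t) *_) (unit-row (isHNF sub) Ass≡1 (ι t) (ι-avoids-units Ass≡1 t)))
              (ℤP.*-zeroʳ (c (inject₁ t)))))
      (ℤP.+-identityˡ (c (fromℕ k)))
    open ≡-Reasoning
    u≗x∘ρ : ∀ i → u i ≡ x (ρ i)
    u≗x∘ρ i = begin
      u i
        ≡⟨ u≡ i ⟩
      Σᶠ (λ t → c t * minor i t)
        ≡⟨ Σᶠ-init-last (λ t → c t * minor i t) ⟩
      Σᶠ (λ t → c (inject₁ t) * minor i (inject₁ t)) + c (fromℕ k) * minor i (fromℕ k)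
        ≡⟨ cong₂ _+_ (Σᶠ-cong λ t → cong (c (inject₁ t) *_) (minor-innerCol i t))
                     (trans (cong (c (fromℕ k) *_) (minor-lastCol i)) (ℤP.*-identityʳ (c (fromℕ k)))) ⟩
      x (ρ i) ∎

  minor-∘-closed : ∀ (u w : Vect (suc k)) → InColSpan u minor → InColSpan w minor
    → InColSpan (u ∘ᶜ w) minor
  minor-∘-closed u w u∈ w∈ =
    InSpan-resp {w = col minor} (λ i → sym (cong₂ _*_ (restricts U i) (restricts W i)))
      (restrict-colSpan (colSpan-∘-closed sub (vec U) (vec W) (vec∈ U) (vec∈ W))
                        (UnitConstant-∘ (unitConstant U) (unitConstant W)))
    where
    open Lift
    U : Lift u
    U = colSpan-lift u∈
    W : Lift w
    W = colSpan-lift w∈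

  minor-isSubringMatrix : IsSubringMatrix minor
  minor-isSubringMatrix =
    minor-invertible , (minor-lower , minor-upper) ,
    InSpan-resp {w = col minor} minor-lastCol (InSpan-member {w = col minor} (fromℕ k)) , minor-∘-closed

  module _ {p} (p-prime : Prime p) (pivots : ∀ s → IsPowerOf p (A s s)) where

    ι-column-∣ : ∀ t r → (+ p) ∣ A r (ι t)
    ι-column-∣ t = prime-∣-column sub p-prime pivots
      ([ ⊥-elim ∘ ι-nonunit t , id ]′ (IsPowerOf⇒≡1⊎∣ p-prime (pivots (ι t))))

    minor-irreducible : IsIrreducibleSubringMatrix p minor
    minor-irreducible = minor-isSubringMatrix , det-power , minor-lastCol , minor-innerCol-∣
      where
      det-power : IsPowerOf p (det minor)
      det-power = subst (IsPowerOf p) (sym (det-upperTriangular minor minor-lower))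
        (Πᶠ-IsPowerOf λ i → subst (IsPowerOf p) (sym (minor-diag i)) (pivots (ρ i)))
      minor-innerCol-∣ : ∀ i t → (+ p) ∣ minor i (inject₁ t)
      minor-innerCol-∣ i t = subst ((+ p) ∣_) (sym (minor-innerCol i t)) (ι-column-∣ t (ρ i))

proposition4p7 : (p : ℕ) → Prime p → (m : ℕ) → (A : Matrix (suc m)) → IsSubringMatrix A
  → (e : Fin m → ℕ)
  → (∀ j → A (inject₁ j) (inject₁ j) ≡ + (p ^ e j))
  → A (fromℕ m) (fromℕ m) ≡ 1ℤ
  → (k : ℕ) → (ι : Fin k → Fin m) → StrictlyIncreasing ι
  → (∀ j → (e j ≢ 0) ⇔ (∃ λ t → ι t ≡ j))
  → (∀ (j₁ j₂ : Fin k) → j₁ ≤ j₂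
       → InSpan (col A (inject₁ (ι j₁)) ∘ᶜ col A (inject₁ (ι j₂))) (λ t → col A (inject₁ (ι t))))
    × IsIrreducibleSubringMatrix p (extendMatrix (λ r t → A (inject₁ (ι r)) (inject₁ (ι t))))
    × (∀ (j₁ j₂ : Fin k) → j₁ ≤ j₂ → (+ p) ∣ A (inject₁ (ι j₁)) (inject₁ (ι j₂)))
    × (∀ (i : Fin m) → e i ≢ 0 → ∀ (r : Fin (suc m)) → (+ p) ∣ A r (inject₁ i))
-- (1) and (3) hold for all pairs j₁, j₂.
proposition4p7 p p-prime m A sub e pivot-e last-unit k ι ι-mono e≢0⇔ι =
    (λ a b _ → ι-product-span a b)
  , minor-irreducible p-prime pivots
  , (λ a b _ → ι-column-∣ p-prime pivots b (inject₁ (ι a)))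
  , column-∣
  where
  pivots : ∀ s → IsPowerOf p (A s s)
  pivots s with innerOrLast s
  ... | inner j = e j , pivot-e j
  ... | last    = 0 , last-unit

  nonunit : ∀ t → A (inject₁ (ι t)) (inject₁ (ι t)) ≢ 1ℤ
  nonunit t Aιι≡1 = Equivalence.from (e≢0⇔ι (ι t)) (t , refl)
    (p^e≡1⇒e≡0 p-prime (trans (sym (pivot-e (ι t))) Aιι≡1))

  off-ι-unit : ∀ s → (∀ t → inject₁ (ι t) ≢ s) → A s s ≡ 1ℤ
  off-ι-unit s s∉ι with innerOrLast s
  ... | last    = last-unit
  ... | inner j with e j ℕ.≟ 0
  ...   | yes e≡0 = trans (pivot-e j) (cong (λ E → + (p ^ E)) e≡0)
  ...   | no e≢0 with Equivalence.to (e≢0⇔ι j) e≢0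
  ...     | t , ιt≡j = ⊥-elim (s∉ι t (cong inject₁ ιt≡j))

  open NonUnitMinor sub last-unit (λ a b a<b → inject₁-<-mono (ι-mono a b a<b)) nonunit off-ι-unit

  column-∣ : ∀ i → e i ≢ 0 → ∀ r → (+ p) ∣ A r (inject₁ i)
  column-∣ i e≢0 with Equivalence.to (e≢0⇔ι i) e≢0
  ... | t , refl = ι-column-∣ p-prime pivots t
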